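{- Let $n$ be a positive integer and $I\subseteq\binom{[n]}{3}$ a set of pairwise disjoint $3$-element subsets of $[n]$. Let $(C^1,(x_1,\dots,x_n),(y_1,\dots,y_n),L^1)$ be a NOT-$111$ gadget for $I$ and $(C^2,(x'_1,\dots,x'_n),(y'_1,\dots,y'_n),L^2)$ a NOT-$222$ gadget for $I$, on disjoint vertex sets. Chaining them (identifying $y_i$ with $x'_i$ for each $i$, ordering all vertices of $C^1$ before the remaining vertices of $C^2$, and taking the union of the list functions) yields a NAE gadget $(C,(x_1,\dots,x_n),(y'_1,\dots,y'_n),L)$ for $I$.
   Context: An ordered graph is a finite simple graph with a fixed linear order of its vertices. $M$ is the ordered graph on $v_1\prec v_2\prec v_3\prec v_4$ with exactly the edges $v_1v_4,v_2v_3$; $M$-free means no induced order-preserving copy of $M$. For positive integers $\ell,\ell'$, a link is a tuple $(F,(x_1,\ldots,x_\ell),(y_1,\ldots,y_{\ell'}))$ with $F$ an ordered graph such that $x_1,\dots,x_\ell$ are in this order the first $\ell$ vertices of $F$, $y_1,\dots,y_{\ell'}$ are in this order the last $\ell'$ vertices, the sets $\{x_i\}$ and $\{y_j\}$ are disjoint and independent, and $F$ is $M$-free. For an ordered graph $C$ and $L:V(C)\to 2^{[4]}$, a coloring of $(C,L)$ is a proper coloring $f$ with $f(v)\in L(v)$ for all $v$. For $c\in\{1,2\}$, a NOT-$ccc$ gadget for $I$ is a tuple $(C,(x_1,\ldots,x_n),(y_1,\ldots,y_n),L)$ where the first three entries form a link, $L:V(C)\to 2^{[4]}$, and: (C1)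 $L(x_i)=L(y_i)=\{1,2\}$ for all $i$; (C2) every $f:\{x_1,\dots,x_n\}\to\{1,2\}$ with $\{f(x_i),f(x_j),f(x_k)\}\neq\{c\}$ for all $\{i,j,k\}\in I$ extends to a coloring of $(C,L)$; (C3) every coloring $f$ of $(C,L)$ satisfies $f(x_i)=f(y_i)$ for all $i$ and $\{f(x_i),f(x_j),f(x_k)\}\neq\{c\}$ for all $\{i,j,k\}\in I$. A NAE gadget for $I$ is defined identically except that in (C2) and (C3) the condition is $\{f(x_i),f(x_j),f(x_k)\}=\{1,2\}$ for all $\{i,j,k\}\in I$. -}

module Defs where

open import Data.Nat as ℕ using (ℕ)
open import Data.Nat.Properties using (+-assoc; +-comm)
open import Data.Fin using (Fin; zero; suc; _<_; _↑ˡ_; _↑ʳ_; cast; splitAt)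
open import Data.Product using (Σ; ∃; ∃-syntax; _×_; _,_)
open import Data.Sum using (_⊎_; [_,_])
open import Data.List using (List)
open import Data.List.Membership.Propositional using (_∈_)
open import Relation.Nullary using (¬_)
open import Relation.Binary.PropositionalEquality using (_≡_; _≢_; sym; trans; cong)
open import Function.Bundles using (_⇔_)

-- Colours [4] = {1,2,3,4} are represented by Fin 4; colour k is the Fin (k-1).
Colour : Set
Colour = Fin 4

col1 col2 : Colour
col1 = zero
col2 = suc zero

-- An ordered graph on N vertices: vertex set Fin N with its natural linear order,
-- edge relation E.  "Simple" = symmetric and irreflexive.
Graph : ℕ → Set₁
Graph N = Fin N → Fin N → Set

IsSimple : ∀ {N} → Graph N → Set
IsSimple {N} E = (∀ u v → E u v → E v u) × (∀ u → ¬ E u u)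

MFree : ∀ {N} → Graph N → Set
MFree {N} E = ¬ (Σ (Fin N) λ a → Σ (Fin N) λ b → Σ (Fin N) λ c → Σ (Fin N) λ d →
  (a < b) × (b < c) × (c < d) ×
  E a d × E b c × ¬ E a b × ¬ E a c × ¬ E b d × ¬ E c d)

-- Graphs with n + m + n vertices: x_i is the i-th vertex, y_i the (n+m+i)-th.
xPos : ∀ {n m} → Fin n → Fin (n ℕ.+ m ℕ.+ n)
xPos {n} {m} i = (i ↑ˡ m) ↑ˡ n

yPos : ∀ {n m} → Fin n → Fin (n ℕ.+ m ℕ.+ n)
yPos {n} {m} i = (n ℕ.+ m) ↑ʳ i

IsLink : ∀ n m → Graph (n ℕ.+ m ℕ.+ n) → Set
IsLink n m E =
  IsSimple E ×
  (∀ i j → ¬ E (xPos {n} {m} i) (xPos {n} {m} j)) ×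
  (∀ i j → ¬ E (yPos {n} {m} i) (yPos {n} {m} j)) ×
  MFree E

ListAssign : ℕ → Set₁
ListAssign N = Fin N → Colour → Set

IsColoring : ∀ {N} → Graph N → ListAssign N → (Fin N → Colour) → Set
IsColoring {N} E L f = (∀ u v → E u v → f u ≢ f v) × (∀ v → L v (f v))

Is12 : Colour → Set
Is12 k = k ≡ col1 ⊎ k ≡ col2

In3 : Colour → Colour → Colour → Colour → Set
In3 a b c k = k ≡ a ⊎ k ≡ b ⊎ k ≡ c

NotAll : Colour → Colour → Colour → Colour → Set
NotAll c a b d = ¬ (∀ k → In3 a b d k ⇔ (k ≡ c))

NAE : Colour → Colour → Colour → Set
NAE a b d = ∀ k → In3 a b d k ⇔ Is12 k

Triple : ℕ → Set
Triple n = Fin n × Fin n × Fin n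

InT : ∀ {n} → Fin n → Triple n → Set
InT a (i , j , k) = a ≡ i ⊎ a ≡ j ⊎ a ≡ k

WellFormed : ∀ {n} → List (Triple n) → Set
WellFormed {n} I =
  (∀ {i j k} → (i , j , k) ∈ I → i ≢ j × i ≢ k × j ≢ k) ×
  (∀ {t t'} → t ∈ I → t' ∈ I →
     (∀ a → InT a t ⇔ InT a t') ⊎ (∀ a → InT a t → InT a t' → ⊥'))
  where open import Data.Empty using () renaming (⊥ to ⊥')

IsGadget : (Colour → Colour → Colour → Set) →
           ∀ n m → List (Triple n) → Graph (n ℕ.+ m ℕ.+ n) → ListAssign (n ℕ.+ m ℕ.+ n) → Set
IsGadget P n m I E L =
  IsLink n m E ×
  (∀ i k → L (xPos {n} {m} i) k ⇔ Is12 k) ×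
  (∀ i k → L (yPos {n} {m} i) k ⇔ Is12 k) ×
  (∀ (f : Fin n → Colour) → (∀ i → Is12 (f i)) →
     (∀ {i j k} → (i , j , k) ∈ I → P (f i) (f j) (f k)) →
     ∃[ g ] (IsColoring E L g × (∀ i → g (xPos {n} {m} i) ≡ f i))) ×
  (∀ (g : Fin (n ℕ.+ m ℕ.+ n) → Colour) → IsColoring E L g →
     (∀ i → g (xPos {n} {m} i) ≡ g (yPos {n} {m} i)) ×
     (∀ {i j k} → (i , j , k) ∈ I →
        P (g (xPos {n} {m} i)) (g (xPos {n} {m} j)) (g (xPos {n} {m} k))))

IsNotGadget : Colour → ∀ n m → List (Triple n) → Graph (n ℕ.+ m ℕ.+ n) → ListAssign (n ℕ.+ m ℕ.+ n) → Set
IsNotGadget c = IsGadget (NotAll c)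

IsNAEGadget : ∀ n m → List (Triple n) → Graph (n ℕ.+ m ℕ.+ n) → ListAssign (n ℕ.+ m ℕ.+ n) → Set
IsNAEGadget = IsGadget NAE

-- The chain has
-- the vertices of C¹ (in order) followed by the vertices of C² other than
-- x'_1..x'_n (in order); x'_i is identified with y_i.

chainEq : ∀ n m₁ m₂ → n ℕ.+ (m₁ ℕ.+ n ℕ.+ m₂) ℕ.+ n ≡ (n ℕ.+ m₁ ℕ.+ n) ℕ.+ (m₂ ℕ.+ n)
chainEq n m₁ m₂ = solve 3 (λ n m₁ m₂ → n :+ (m₁ :+ n :+ m₂) :+ n := (n :+ m₁ :+ n) :+ (m₂ :+ n)) Eq.refl n m₁ m₂
  where
  open import Data.Nat.Solver using (module +-*-Solver)
  open +-*-Solver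
  import Relation.Binary.PropositionalEquality as Eq

ChainV : ∀ n m₁ m₂ → Set
ChainV n m₁ m₂ = Fin (n ℕ.+ (m₁ ℕ.+ n ℕ.+ m₂) ℕ.+ n)

ι₁ : ∀ n m₁ m₂ → Fin (n ℕ.+ m₁ ℕ.+ n) → ChainV n m₁ m₂
ι₁ n m₁ m₂ a = cast (sym (chainEq n m₁ m₂)) (a ↑ˡ (m₂ ℕ.+ n))

ι₂ : ∀ n m₁ m₂ → Fin (n ℕ.+ m₂ ℕ.+ n) → ChainV n m₁ m₂
ι₂ n m₁ m₂ b =
  [ (λ i → ι₁ n m₁ m₂ (yPos {n} {m₁} i))
  , (λ r → cast (sym (chainEq n m₁ m₂)) ((n ℕ.+ m₁ ℕ.+ n) ↑ʳ r))
  ] (splitAt n (cast (+-assoc n m₂ n) b))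

chainE : ∀ n m₁ m₂ → Graph (n ℕ.+ m₁ ℕ.+ n) → Graph (n ℕ.+ m₂ ℕ.+ n) →
         Graph (n ℕ.+ (m₁ ℕ.+ n ℕ.+ m₂) ℕ.+ n)
chainE n m₁ m₂ E₁ E₂ u v =
  (∃[ a ] ∃[ b ] (ι₁ n m₁ m₂ a ≡ u × ι₁ n m₁ m₂ b ≡ v × E₁ a b)) ⊎
  (∃[ a ] ∃[ b ] (ι₂ n m₁ m₂ a ≡ u × ι₂ n m₁ m₂ b ≡ v × E₂ a b))

chainL : ∀ n m₁ m₂ → ListAssign (n ℕ.+ m₁ ℕ.+ n) → ListAssign (n ℕ.+ m₂ ℕ.+ n) →
         ListAssign (n ℕ.+ (m₁ ℕ.+ n ℕ.+ m₂) ℕ.+ n)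
chainL n m₁ m₂ L₁ L₂ u k =
  (∃[ a ] (ι₁ n m₁ m₂ a ≡ u × L₁ a k)) ⊎
  (∃[ b ] (ι₂ n m₁ m₂ b ≡ u × L₂ b k))

module Submission where

-- The chain is glued from C¹ and C² along the shared vertices y_i = x'_i, which are independent in
-- both parts; so an induced M in the chain lies in one part or has its middle edge between two shared
-- vertices, and colourings of the chain are exactly pairs of colourings of the parts agreeing on the
-- shared vertices.  By (C3) for C¹ a colouring satisfies f(y_i) = f(x_i), so the x-colours of every
-- triple avoid both 111 and 222, which for colours from {1,2} means NAE; conversely such an
-- assignment extends to both gadgets, and the two extensions agree on the shared vertices.

open import Defs
open import Data.Nat using (ℕ; _+_; _≤_; _<_; _∸_; _<?_)
open import Data.List using (List)
open import Data.List.Membership.Propositional using (_∈_)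

open import Data.Nat.Properties
  using (+-assoc; +-cancelˡ-≡; +-cancelˡ-<; m+[n∸m]≡n; m≤m+n; ≤-trans; ≤-<-trans; <-trans; <⇒≤; <⇒≱; ≮⇒≥;
         module ≤-Reasoning)
open import Data.Nat.Solver using (module +-*-Solver)
open import Data.Fin as Fin using (Fin; toℕ; fromℕ<; splitAt; cast)
open import Data.Fin.Properties
  using (toℕ-injective; toℕ-↑ˡ; toℕ-↑ʳ; toℕ-cast; toℕ-fromℕ<; toℕ<n; splitAt⁻¹-↑ˡ; splitAt⁻¹-↑ʳ)
open import Data.Product using (∃-syntax; _×_; _,_; proj₁; proj₂)
open import Data.Sum using (_⊎_; inj₁; inj₂; [_,_]′; swap)
open import Data.Empty using (⊥-elim)
open import Relation.Nullary using (¬_; yes; no)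
open import Relation.Binary.PropositionalEquality
open import Function.Base using (_∘_; id)
open import Function.Bundles using (_⇔_; mk⇔; Equivalence)
open import Function.Properties.Equivalence using () renaming (trans to ⇔-trans; sym to ⇔-sym)

offset-index : ∀ p {k t} → p ≤ t → t < p + k → ∃[ r ] p + toℕ {k} r ≡ t
offset-index p {k} {t} p≤t t<p+k =
  fromℕ< t∸p<k , trans (cong (p +_) (toℕ-fromℕ< t∸p<k)) (m+[n∸m]≡n p≤t)
  where
  t∸p<k : t ∸ p < k
  t∸p<k = +-cancelˡ-< p _ _ (subst (_< p + k) (sym (m+[n∸m]≡n p≤t)) t<p+k)

module _ {n m : ℕ} where

  toℕ-xPos : (i : Fin n) → toℕ (xPos {n} {m} i) ≡ toℕ i
  toℕ-xPos i = trans (toℕ-↑ˡ _ n) (toℕ-↑ˡ i m)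

  toℕ-yPos : (i : Fin n) → toℕ (yPos {n} {m} i) ≡ n + m + toℕ i
  toℕ-yPos = toℕ-↑ʳ (n + m)

  xPos≢yPos : ∀ i j → xPos {n} {m} i ≢ yPos j
  xPos≢yPos i j eq = <⇒≱ (toℕ<n i) (begin
    n                     ≤⟨ ≤-trans (m≤m+n n m) (m≤m+n (n + m) (toℕ j)) ⟩
    n + m + toℕ j         ≡⟨ sym (toℕ-yPos j) ⟩
    toℕ (yPos {n} {m} j)  ≡⟨ cong toℕ eq ⟨
    toℕ (xPos {n} {m} i)  ≡⟨ toℕ-xPos i ⟩
    toℕ i                 ∎)
    where open ≤-Reasoning

  xPos-of-< : (a : Fin (n + m + n)) (a<n : toℕ a < n) → a ≡ xPos (fromℕ< a<n)
  xPos-of-< a a<n = toℕ-injective (sym (trans (toℕ-xPos _) (toℕ-fromℕ< a<n)))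

  yPos-of-≥ : (a : Fin (n + m + n)) → n + m ≤ toℕ a → ∃[ j ] a ≡ yPos j
  yPos-of-≥ a n+m≤a =
    let j , eq = offset-index (n + m) n+m≤a (toℕ<n a)
    in  j , toℕ-injective (sym (trans (toℕ-yPos j) eq))

module Chain (n m₁ m₂ : ℕ) where

  ι¹ : Fin (n + m₁ + n) → ChainV n m₁ m₂
  ι¹ = ι₁ n m₁ m₂

  ι² : Fin (n + m₂ + n) → ChainV n m₁ m₂
  ι² = ι₂ n m₁ m₂

  toℕ-ι¹ : ∀ a → toℕ (ι¹ a) ≡ toℕ a
  toℕ-ι¹ a = trans (toℕ-cast _ (a Fin.↑ˡ (m₂ + n))) (toℕ-↑ˡ a (m₂ + n))

  toℕ-ι² : ∀ b → toℕ (ι² b) ≡ n + m₁ + toℕ b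
  toℕ-ι² b with splitAt n (cast (+-assoc n m₂ n) b) in split
  ... | inj₁ j = begin
    toℕ (ι¹ (yPos j))  ≡⟨ trans (toℕ-ι¹ _) (toℕ-yPos j) ⟩
    n + m₁ + toℕ j     ≡⟨ cong (n + m₁ +_) (trans (sym (toℕ-↑ˡ j (m₂ + n))) b≡j) ⟩
    n + m₁ + toℕ b     ∎
    where
    open ≡-Reasoning
    b≡j : toℕ (j Fin.↑ˡ (m₂ + n)) ≡ toℕ b
    b≡j = trans (cong toℕ (splitAt⁻¹-↑ˡ split)) (toℕ-cast _ b)
  ... | inj₂ r = begin
    toℕ (cast _ ((n + m₁ + n) Fin.↑ʳ r))  ≡⟨ trans (toℕ-cast _ _) (toℕ-↑ʳ (n + m₁ + n) r) ⟩
    n + m₁ + n + toℕ r                     ≡⟨ +-assoc (n + m₁) n (toℕ r) ⟩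
    n + m₁ + (n + toℕ r)                   ≡⟨ cong (n + m₁ +_) (trans (sym (toℕ-↑ʳ n r)) b≡r) ⟩
    n + m₁ + toℕ b                         ∎
    where
    open ≡-Reasoning
    b≡r : toℕ (n Fin.↑ʳ r) ≡ toℕ b
    b≡r = trans (cong toℕ (splitAt⁻¹-↑ʳ split)) (toℕ-cast _ b)

  ι¹-injective : ∀ {a a'} → ι¹ a ≡ ι¹ a' → a ≡ a'
  ι¹-injective {a} {a'} eq = toℕ-injective (trans (sym (toℕ-ι¹ a)) (trans (cong toℕ eq) (toℕ-ι¹ a')))

  ι²-injective : ∀ {b b'} → ι² b ≡ ι² b' → b ≡ b'
  ι²-injective {b} {b'} eq =
    toℕ-injective (+-cancelˡ-≡ (n + m₁) _ _ (trans (sym (toℕ-ι² b)) (trans (cong toℕ eq) (toℕ-ι² b'))))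

  ι¹-yPos≡ι²-xPos : ∀ j → ι¹ (yPos {n} {m₁} j) ≡ ι² (xPos {n} {m₂} j)
  ι¹-yPos≡ι²-xPos j = toℕ-injective (begin
    toℕ (ι¹ (yPos j))          ≡⟨ trans (toℕ-ι¹ _) (toℕ-yPos j) ⟩
    n + m₁ + toℕ j             ≡⟨ cong (n + m₁ +_) (toℕ-xPos j) ⟨
    n + m₁ + toℕ (xPos {n} {m₂} j) ≡⟨ toℕ-ι² _ ⟨
    toℕ (ι² (xPos j))          ∎)
    where open ≡-Reasoning

  ι¹≡ι²⇒shared : ∀ {a b} → ι¹ a ≡ ι² b → ∃[ j ] a ≡ yPos {n} {m₁} j × b ≡ xPos {n} {m₂} j
  ι¹≡ι²⇒shared {a} {b} eq =
    j , ι¹-injective (trans eq (trans (cong ι² b≡xPos) (sym (ι¹-yPos≡ι²-xPos j)))) , b≡xPos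
    where
    b<n : toℕ b < n
    b<n = +-cancelˡ-< (n + m₁) _ _
      (subst (_< n + m₁ + n) (trans (sym (toℕ-ι¹ a)) (trans (cong toℕ eq) (toℕ-ι² b))) (toℕ<n a))
    j = fromℕ< b<n
    b≡xPos : b ≡ xPos j
    b≡xPos = xPos-of-< {m = m₂} b b<n

  ι¹-xPos≢ι² : ∀ i b → ι¹ (xPos {n} {m₁} i) ≢ ι² b
  ι¹-xPos≢ι² i b eq = let j , x≡y , _ = ι¹≡ι²⇒shared eq in xPos≢yPos i j x≡y

  ι¹≢ι²-yPos : ∀ a i → ι¹ a ≢ ι² (yPos {n} {m₂} i)
  ι¹≢ι²-yPos a i eq = let j , _ , y≡x = ι¹≡ι²⇒shared eq in xPos≢yPos j i (sym y≡x)

  xPos≡ι¹-xPos : ∀ i → xPos {n} {m₁ + n + m₂} i ≡ ι¹ (xPos {n} {m₁} i)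
  xPos≡ι¹-xPos i = toℕ-injective (trans (toℕ-xPos i) (sym (trans (toℕ-ι¹ _) (toℕ-xPos i))))

  yPos≡ι²-yPos : ∀ i → yPos {n} {m₁ + n + m₂} i ≡ ι² (yPos {n} {m₂} i)
  yPos≡ι²-yPos i = toℕ-injective (begin
    toℕ (yPos {n} {m₁ + n + m₂} i)  ≡⟨ toℕ-yPos i ⟩
    n + (m₁ + n + m₂) + toℕ i       ≡⟨ solve 4 (λ n m₁ m₂ t → n :+ (m₁ :+ n :+ m₂) :+ t := n :+ m₁ :+ (n :+ m₂ :+ t))
                                         refl n m₁ m₂ (toℕ i) ⟩
    n + m₁ + (n + m₂ + toℕ i)       ≡⟨ cong (n + m₁ +_) (toℕ-yPos i) ⟨
    n + m₁ + toℕ (yPos {n} {m₂} i)  ≡⟨ toℕ-ι² _ ⟨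
    toℕ (ι² (yPos i))               ∎)
    where
    open ≡-Reasoning
    open +-*-Solver

  cover : ∀ u → (∃[ a ] ι¹ a ≡ u) ⊎ (∃[ b ] ι² b ≡ u)
  cover u with toℕ u <? n + m₁ + n
  ... | yes u<N₁ = inj₁ (fromℕ< u<N₁ , toℕ-injective (trans (toℕ-ι¹ _) (toℕ-fromℕ< u<N₁)))
  ... | no u≮N₁ =
    let b , eq = offset-index (n + m₁) (≤-trans (m≤m+n (n + m₁) n) (≮⇒≥ u≮N₁)) u<N
    in  inj₂ (b , toℕ-injective (trans (toℕ-ι² b) eq))
    where
    open +-*-Solver
    u<N : toℕ u < n + m₁ + (n + m₂ + n)
    u<N = subst (toℕ u <_) (solve 3 (λ n m₁ m₂ → n :+ (m₁ :+ n :+ m₂) :+ n := n :+ m₁ :+ (n :+ m₂ :+ n))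
                                     refl n m₁ m₂) (toℕ<n u)

  ι¹-<-reflects : ∀ {a a'} → toℕ (ι¹ a) < toℕ (ι¹ a') → toℕ a < toℕ a'
  ι¹-<-reflects {a} {a'} = subst₂ _<_ (toℕ-ι¹ a) (toℕ-ι¹ a')

  ι²-<-reflects : ∀ {b b'} → toℕ (ι² b) < toℕ (ι² b') → toℕ b < toℕ b'
  ι²-<-reflects {b} {b'} lt = +-cancelˡ-< (n + m₁) _ _ (subst₂ _<_ (toℕ-ι² b) (toℕ-ι² b') lt)

  ι²<ι¹⇒shared : ∀ {a b} → toℕ (ι² b) < toℕ (ι¹ a) → toℕ b < n × n + m₁ ≤ toℕ a
  ι²<ι¹⇒shared {a} {b} lt =
      +-cancelˡ-< (n + m₁) _ _ (<-trans b<a (toℕ<n a))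
    , <⇒≤ (≤-<-trans (m≤m+n (n + m₁) (toℕ b)) b<a)
    where
    b<a : n + m₁ + toℕ b < toℕ a
    b<a = subst₂ _<_ (toℕ-ι² b) (toℕ-ι¹ a) lt

  module _ {E₁ : Graph (n + m₁ + n)} {E₂ : Graph (n + m₂ + n)} where

    private
      E : Graph (n + (m₁ + n + m₂) + n)
      E = chainE n m₁ m₂ E₁ E₂

      lift₁ : ∀ {a a'} → E₁ a a' → E (ι¹ a) (ι¹ a')
      lift₁ e = inj₁ (_ , _ , refl , refl , e)

      lift₂ : ∀ {b b'} → E₂ b b' → E (ι² b) (ι² b')
      lift₂ e = inj₂ (_ , _ , refl , refl , e)

    chainE-isSimple : IsSimple E₁ → IsSimple E₂ → IsSimple E
    chainE-isSimple (sym₁ , irr₁) (sym₂ , irr₂) = symmetric , irreflexive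
      where
      symmetric : ∀ u v → E u v → E v u
      symmetric _ _ (inj₁ (a , a' , refl , refl , e)) = lift₁ (sym₁ a a' e)
      symmetric _ _ (inj₂ (b , b' , refl , refl , e)) = lift₂ (sym₂ b b' e)
      irreflexive : ∀ u → ¬ E u u
      irreflexive _ (inj₁ (a , a' , refl , eq , e)) = irr₁ a (subst (E₁ a) (ι¹-injective eq) e)
      irreflexive _ (inj₂ (b , b' , refl , eq , e)) = irr₂ b (subst (E₂ b) (ι²-injective eq) e)

    chainE-xPos-independent : (∀ i j → ¬ E₁ (xPos {n} {m₁} i) (xPos {n} {m₁} j)) →
                              ∀ i j → ¬ E (xPos i) (xPos j)
    chainE-xPos-independent indep₁ i j (inj₁ (a , a' , eq , eq' , e)) =
      indep₁ i j (subst₂ E₁ (ι¹-injective (trans eq (xPos≡ι¹-xPos i)))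
                            (ι¹-injective (trans eq' (xPos≡ι¹-xPos j))) e)
    chainE-xPos-independent indep₁ i j (inj₂ (b , _ , eq , _ , _)) =
      ι¹-xPos≢ι² i b (trans (sym (xPos≡ι¹-xPos i)) (sym eq))

    chainE-yPos-independent : (∀ i j → ¬ E₂ (yPos {n} {m₂} i) (yPos {n} {m₂} j)) →
                              ∀ i j → ¬ E (yPos i) (yPos j)
    chainE-yPos-independent indep₂ i j (inj₂ (b , b' , eq , eq' , e)) =
      indep₂ i j (subst₂ E₂ (ι²-injective (trans eq (yPos≡ι²-yPos i)))
                            (ι²-injective (trans eq' (yPos≡ι²-yPos j))) e)
    chainE-yPos-independent indep₂ i j (inj₁ (a , _ , eq , _ , _)) =
      ι¹≢ι²-yPos a i (trans eq (yPos≡ι²-yPos i))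

    chainE-MFree : MFree E₁ → MFree E₂ →
                   (∀ i j → ¬ E₂ (xPos {n} {m₂} i) (xPos {n} {m₂} j)) →
                   (∀ i j → ¬ E₁ (yPos {n} {m₁} i) (yPos {n} {m₁} j)) → MFree E
    chainE-MFree mfree₁ _ _ _ (_ , _ , _ , _ , ab , bc , cd ,
        inj₁ (a , d , refl , refl , ad) , inj₁ (b , c , refl , refl , bc∈) , ab∉ , ac∉ , bd∉ , cd∉) =
      mfree₁ (a , b , c , d , ι¹-<-reflects ab , ι¹-<-reflects bc , ι¹-<-reflects cd , ad , bc∈ ,
              ab∉ ∘ lift₁ , ac∉ ∘ lift₁ , bd∉ ∘ lift₁ , cd∉ ∘ lift₁)
    chainE-MFree _ mfree₂ _ _ (_ , _ , _ , _ , ab , bc , cd ,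
        inj₂ (a , d , refl , refl , ad) , inj₂ (b , c , refl , refl , bc∈) , ab∉ , ac∉ , bd∉ , cd∉) =
      mfree₂ (a , b , c , d , ι²-<-reflects ab , ι²-<-reflects bc , ι²-<-reflects cd , ad , bc∈ ,
              ab∉ ∘ lift₂ , ac∉ ∘ lift₂ , bd∉ ∘ lift₂ , cd∉ ∘ lift₂)
    chainE-MFree _ _ xindep₂ _ (_ , _ , _ , _ , _ , bc , cd ,
        inj₁ (_ , d , refl , refl , _) , inj₂ (b , c , refl , refl , bc∈) , _) =
      xindep₂ _ _ (subst₂ E₂ (xPos-of-< {m = m₂} b b<n) (xPos-of-< {m = m₂} c c<n) bc∈)
      where
      c<n : toℕ c < n
      c<n = proj₁ (ι²<ι¹⇒shared {d} cd)
      b<n : toℕ b < n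
      b<n = <-trans (ι²-<-reflects bc) c<n
    chainE-MFree _ _ _ yindep₁ (_ , _ , _ , _ , ab , bc , _ ,
        inj₂ (a , _ , refl , refl , _) , inj₁ (b , c , refl , refl , bc∈) , _) =
      let i , b≡y = yPos-of-≥ {m = m₁} b (proj₂ (ι²<ι¹⇒shared {b} {a} ab))
          j , c≡y = yPos-of-≥ {m = m₁} c (proj₂ (ι²<ι¹⇒shared {c} {a} (<-trans ab bc)))
      in  yindep₁ i j (subst₂ E₁ b≡y c≡y bc∈)

    chain-isLink : IsLink n m₁ E₁ → IsLink n m₂ E₂ → IsLink n (m₁ + n + m₂) E
    chain-isLink (simple₁ , xindep₁ , yindep₁ , mfree₁) (simple₂ , xindep₂ , yindep₂ , mfree₂) =
        chainE-isSimple simple₁ simple₂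
      , chainE-xPos-independent xindep₁
      , chainE-yPos-independent yindep₂
      , chainE-MFree mfree₁ mfree₂ xindep₂ yindep₁

  module Lists (L₁ : ListAssign (n + m₁ + n)) (L₂ : ListAssign (n + m₂ + n))
               (shared : ∀ j k → L₁ (yPos {n} {m₁} j) k ⇔ L₂ (xPos {n} {m₂} j) k) where

    chainL-ι¹ : ∀ a k → chainL n m₁ m₂ L₁ L₂ (ι¹ a) k ⇔ L₁ a k
    chainL-ι¹ a k = mk⇔ to (λ l → inj₁ (a , refl , l))
      where
      to : chainL n m₁ m₂ L₁ L₂ (ι¹ a) k → L₁ a k
      to (inj₁ (a' , eq , l)) = subst (λ v → L₁ v k) (ι¹-injective eq) l
      to (inj₂ (b , eq , l)) =
        let j , a≡y , b≡x = ι¹≡ι²⇒shared (sym eq)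
        in  subst (λ v → L₁ v k) (sym a≡y) (Equivalence.from (shared j k) (subst (λ v → L₂ v k) b≡x l))

    chainL-ι² : ∀ b k → chainL n m₁ m₂ L₁ L₂ (ι² b) k ⇔ L₂ b k
    chainL-ι² b k = mk⇔ to (λ l → inj₂ (b , refl , l))
      where
      to : chainL n m₁ m₂ L₁ L₂ (ι² b) k → L₂ b k
      to (inj₂ (b' , eq , l)) = subst (λ v → L₂ v k) (ι²-injective eq) l
      to (inj₁ (a , eq , l)) =
        let j , a≡y , b≡x = ι¹≡ι²⇒shared eq
        in  subst (λ v → L₂ v k) (sym b≡x) (Equivalence.to (shared j k) (subst (λ v → L₁ v k) a≡y l))

  glue : {A : Set} → (Fin (n + m₁ + n) → A) → (Fin (n + m₂ + n) → A) → ChainV n m₁ m₂ → A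
  glue g₁ g₂ u = [ g₁ ∘ proj₁ , g₂ ∘ proj₁ ]′ (cover u)

  module _ {A : Set} (g₁ : Fin (n + m₁ + n) → A) (g₂ : Fin (n + m₂ + n) → A)
           (agree : ∀ j → g₁ (yPos {n} {m₁} j) ≡ g₂ (xPos {n} {m₂} j)) where

    glue-ι¹ : ∀ a → glue g₁ g₂ (ι¹ a) ≡ g₁ a
    glue-ι¹ a with cover (ι¹ a)
    ... | inj₁ (a' , eq) = cong g₁ (ι¹-injective eq)
    ... | inj₂ (b , eq) =
      let j , a≡y , b≡x = ι¹≡ι²⇒shared (sym eq)
      in  trans (cong g₂ b≡x) (trans (sym (agree j)) (cong g₁ (sym a≡y)))

    glue-ι² : ∀ b → glue g₁ g₂ (ι² b) ≡ g₂ b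
    glue-ι² b with cover (ι² b)
    ... | inj₂ (b' , eq) = cong g₂ (ι²-injective eq)
    ... | inj₁ (a , eq) =
      let j , a≡y , b≡x = ι¹≡ι²⇒shared eq
      in  trans (cong g₁ a≡y) (trans (agree j) (cong g₂ (sym b≡x)))

  module Colourings (E₁ : Graph (n + m₁ + n)) (E₂ : Graph (n + m₂ + n))
                    (L₁ : ListAssign (n + m₁ + n)) (L₂ : ListAssign (n + m₂ + n))
                    (shared : ∀ j k → L₁ (yPos {n} {m₁} j) k ⇔ L₂ (xPos {n} {m₂} j) k) where

    open Lists L₁ L₂ shared

    private
      E = chainE n m₁ m₂ E₁ E₂
      L = chainL n m₁ m₂ L₁ L₂

    restrict₁-isColoring : ∀ {g} → IsColoring E L g → IsColoring E₁ L₁ (g ∘ ι¹)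
    restrict₁-isColoring (proper , inList) =
        (λ a a' e → proper _ _ (inj₁ (a , a' , refl , refl , e)))
      , (λ a → Equivalence.to (chainL-ι¹ a _) (inList (ι¹ a)))

    restrict₂-isColoring : ∀ {g} → IsColoring E L g → IsColoring E₂ L₂ (g ∘ ι²)
    restrict₂-isColoring (proper , inList) =
        (λ b b' e → proper _ _ (inj₂ (b , b' , refl , refl , e)))
      , (λ b → Equivalence.to (chainL-ι² b _) (inList (ι² b)))

    glue-isColoring : ∀ {g₁ g₂} (agree : ∀ j → g₁ (yPos {n} {m₁} j) ≡ g₂ (xPos {n} {m₂} j)) →
                      IsColoring E₁ L₁ g₁ → IsColoring E₂ L₂ g₂ → IsColoring E L (glue g₁ g₂)
    glue-isColoring {g₁} {g₂} agree (proper₁ , inList₁) (proper₂ , inList₂) = proper , inList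
      where
      glued₁ : ∀ a → glue g₁ g₂ (ι¹ a) ≡ g₁ a
      glued₁ = glue-ι¹ g₁ g₂ agree
      glued₂ : ∀ b → glue g₁ g₂ (ι² b) ≡ g₂ b
      glued₂ = glue-ι² g₁ g₂ agree
      proper : ∀ u v → E u v → glue g₁ g₂ u ≢ glue g₁ g₂ v
      proper _ _ (inj₁ (a , a' , refl , refl , e)) eq =
        proper₁ a a' e (trans (sym (glued₁ a)) (trans eq (glued₁ a')))
      proper _ _ (inj₂ (b , b' , refl , refl , e)) eq =
        proper₂ b b' e (trans (sym (glued₂ b)) (trans eq (glued₂ b')))
      inList : ∀ u → L u (glue g₁ g₂ u)
      inList u with cover u
      ... | inj₁ (a , refl) = inj₁ (a , refl , inList₁ a)
      ... | inj₂ (b , refl) = inj₂ (b , refl , inList₂ b)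

subst₃ : {A : Set} (Q : A → A → A → Set) {a a' b b' c c' : A} →
         a ≡ a' → b ≡ b' → c ≡ c' → Q a b c → Q a' b' c'
subst₃ Q refl refl refl q = q

module _ {P P₁ P₂ : Colour → Colour → Colour → Set}
         (P⇔P₁×P₂ : ∀ {a b c} → Is12 a → Is12 b → Is12 c → P a b c ⇔ (P₁ a b c × P₂ a b c))
         {n m₁ m₂ : ℕ} {I : List (Triple n)}
         {E₁ : Graph (n + m₁ + n)} {L₁ : ListAssign (n + m₁ + n)}
         {E₂ : Graph (n + m₂ + n)} {L₂ : ListAssign (n + m₂ + n)} where

  open Chain n m₁ m₂

  private
    Gadget₁ Gadget₂ : Set
    Gadget₁ = IsGadget P₁ n m₁ I E₁ L₁
    Gadget₂ = IsGadget P₂ n m₂ I E₂ L₂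

    E : Graph (n + (m₁ + n + m₂) + n)
    E = chainE n m₁ m₂ E₁ E₂

    L : ListAssign (n + (m₁ + n + m₂) + n)
    L = chainL n m₁ m₂ L₁ L₂

    x y : Fin n → Fin (n + (m₁ + n + m₂) + n)
    x = xPos
    y = yPos

  sharedLists : Gadget₁ → Gadget₂ → ∀ j k → L₁ (yPos {n} {m₁} j) k ⇔ L₂ (xPos {n} {m₂} j) k
  sharedLists (_ , _ , yLists₁ , _) (_ , xLists₂ , _) j k = ⇔-trans (yLists₁ j k) (⇔-sym (xLists₂ j k))

  chain-xLists : Gadget₁ → Gadget₂ → ∀ i k → L (x i) k ⇔ Is12 k
  chain-xLists G₁@(_ , xLists₁ , _) G₂ i k =
    ⇔-trans (subst (λ v → L v k ⇔ L₁ (xPos i) k) (sym (xPos≡ι¹-xPos i)) (chainL-ι¹ (xPos i) k))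
            (xLists₁ i k)
    where open Lists L₁ L₂ (sharedLists G₁ G₂)

  chain-yLists : Gadget₁ → Gadget₂ → ∀ i k → L (y i) k ⇔ Is12 k
  chain-yLists G₁ G₂@(_ , _ , yLists₂ , _) i k =
    ⇔-trans (subst (λ v → L v k ⇔ L₂ (yPos i) k) (sym (yPos≡ι²-yPos i)) (chainL-ι² (yPos i) k))
            (yLists₂ i k)
    where open Lists L₁ L₂ (sharedLists G₁ G₂)

  glue-extends : Gadget₁ → Gadget₂ →
                 ∀ {f : Fin n → Colour} {g₁ : Fin (n + m₁ + n) → Colour} {g₂ : Fin (n + m₂ + n) → Colour} →
                 IsColoring E₁ L₁ g₁ → (∀ i → g₁ (xPos i) ≡ f i) →
                 IsColoring E₂ L₂ g₂ → (∀ i → g₂ (xPos i) ≡ f i) →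
                 ∃[ g ] (IsColoring E L g × (∀ i → g (x i) ≡ f i))
  glue-extends G₁@(_ , _ , _ , _ , checks₁) G₂ {f} {g₁} {g₂} colouring₁ g₁-x colouring₂ g₂-x =
    glue g₁ g₂ , glue-isColoring agree colouring₁ colouring₂ , glue-x
    where
    open Colourings E₁ E₂ L₁ L₂ (sharedLists G₁ G₂)
    agree : ∀ j → g₁ (yPos j) ≡ g₂ (xPos j)
    agree j = begin
      g₁ (yPos j)  ≡⟨ proj₁ (checks₁ g₁ colouring₁) j ⟨
      g₁ (xPos j)  ≡⟨ g₁-x j ⟩
      f j          ≡⟨ g₂-x j ⟨
      g₂ (xPos j)  ∎
      where open ≡-Reasoning
    glue-x : ∀ i → glue g₁ g₂ (x i) ≡ f i
    glue-x i = trans (cong (glue g₁ g₂) (xPos≡ι¹-xPos i)) (trans (glue-ι¹ g₁ g₂ agree _) (g₁-x i))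

  chain-extends : Gadget₁ → Gadget₂ → ∀ (f : Fin n → Colour) → (∀ i → Is12 (f i)) →
                  (∀ {i j k} → (i , j , k) ∈ I → P (f i) (f j) (f k)) →
                  ∃[ g ] (IsColoring E L g × (∀ i → g (x i) ≡ f i))
  chain-extends G₁@(_ , _ , _ , extends₁ , _) G₂@(_ , _ , _ , extends₂ , _) f f∈12 fP =
    let g₁ , colouring₁ , g₁-x = extends₁ f f∈12 (proj₁ ∘ P₁×P₂)
        g₂ , colouring₂ , g₂-x = extends₂ f f∈12 (proj₂ ∘ P₁×P₂)
    in  glue-extends G₁ G₂ colouring₁ g₁-x colouring₂ g₂-x
    where
    P₁×P₂ : ∀ {i j k} → (i , j , k) ∈ I → P₁ (f i) (f j) (f k) × P₂ (f i) (f j) (f k)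
    P₁×P₂ {i} {j} {k} t = Equivalence.to (P⇔P₁×P₂ (f∈12 i) (f∈12 j) (f∈12 k)) (fP t)

  chain-checks : Gadget₁ → Gadget₂ → ∀ g → IsColoring E L g →
                 (∀ i → g (x i) ≡ g (y i)) × (∀ {i j k} → (i , j , k) ∈ I → P (g (x i)) (g (x j)) (g (x k)))
  chain-checks G₁@(_ , _ , _ , _ , checks₁) G₂@(_ , _ , _ , _ , checks₂) g colouring = x≡y , triplesP
    where
    open Colourings E₁ E₂ L₁ L₂ (sharedLists G₁ G₂)
    x≡y₁ : ∀ i → g (ι¹ (xPos i)) ≡ g (ι¹ (yPos i))
    x≡y₁ = proj₁ (checks₁ (g ∘ ι¹) (restrict₁-isColoring colouring))
    x≡y₂ : ∀ i → g (ι² (xPos i)) ≡ g (ι² (yPos i))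
    x≡y₂ = proj₁ (checks₂ (g ∘ ι²) (restrict₂-isColoring colouring))
    P₁-ι¹ : ∀ {i j k} → (i , j , k) ∈ I → P₁ (g (ι¹ (xPos i))) (g (ι¹ (xPos j))) (g (ι¹ (xPos k)))
    P₁-ι¹ = proj₂ (checks₁ (g ∘ ι¹) (restrict₁-isColoring colouring))
    P₂-ι² : ∀ {i j k} → (i , j , k) ∈ I → P₂ (g (ι² (xPos i))) (g (ι² (xPos j))) (g (ι² (xPos k)))
    P₂-ι² = proj₂ (checks₂ (g ∘ ι²) (restrict₂-isColoring colouring))
    x-via-ι¹ : ∀ i → g (ι¹ (xPos i)) ≡ g (x i)
    x-via-ι¹ i = cong g (sym (xPos≡ι¹-xPos i))
    x-via-ι² : ∀ i → g (ι² (xPos i)) ≡ g (x i)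
    x-via-ι² i = begin
      g (ι² (xPos i))  ≡⟨ cong g (ι¹-yPos≡ι²-xPos i) ⟨
      g (ι¹ (yPos i))  ≡⟨ x≡y₁ i ⟨
      g (ι¹ (xPos i))  ≡⟨ x-via-ι¹ i ⟩
      g (x i)          ∎
      where open ≡-Reasoning
    x≡y : ∀ i → g (x i) ≡ g (y i)
    x≡y i = trans (sym (x-via-ι² i)) (trans (x≡y₂ i) (cong g (sym (yPos≡ι²-yPos i))))
    x∈12 : ∀ i → Is12 (g (x i))
    x∈12 i = Equivalence.to (chain-xLists G₁ G₂ i _) (proj₂ colouring (x i))
    triplesP : ∀ {i j k} → (i , j , k) ∈ I → P (g (x i)) (g (x j)) (g (x k))
    triplesP {i} {j} {k} t = Equivalence.from (P⇔P₁×P₂ (x∈12 i) (x∈12 j) (x∈12 k))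
      ( subst₃ P₁ (x-via-ι¹ i) (x-via-ι¹ j) (x-via-ι¹ k) (P₁-ι¹ t)
      , subst₃ P₂ (x-via-ι² i) (x-via-ι² j) (x-via-ι² k) (P₂-ι² t))

  chain-isGadget : Gadget₁ → Gadget₂ → IsGadget P n (m₁ + n + m₂) I E L
  chain-isGadget G₁@(link₁ , _) G₂@(link₂ , _) =
      chain-isLink link₁ link₂
    , chain-xLists G₁ G₂
    , chain-yLists G₁ G₂
    , chain-extends G₁ G₂
    , chain-checks G₁ G₂

monochromatic : ∀ c k → In3 c c c k ⇔ (k ≡ c)
monochromatic c k = mk⇔ [ id , [ id , id ]′ ]′ inj₁

other-colour-present : ∀ {c c' a b d} → a ≡ c ⊎ a ≡ c' → b ≡ c ⊎ b ≡ c' → d ≡ c ⊎ d ≡ c' →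
                       NotAll c a b d → In3 a b d c'
other-colour-present (inj₂ refl) _ _ _ = inj₁ refl
other-colour-present _ (inj₂ refl) _ _ = inj₂ (inj₁ refl)
other-colour-present _ _ (inj₂ refl) _ = inj₂ (inj₂ refl)
other-colour-present (inj₁ refl) (inj₁ refl) (inj₁ refl) notAll = ⊥-elim (notAll (monochromatic _))

NAE⇒NotAll : ∀ {c a b d} → Is12 c → NAE a b d → NotAll c a b d
NAE⇒NotAll (inj₁ refl) nae mono with Equivalence.to (mono col2) (Equivalence.from (nae col2) (inj₂ refl))
... | ()
NAE⇒NotAll (inj₂ refl) nae mono with Equivalence.to (mono col1) (Equivalence.from (nae col1) (inj₁ refl))
... | ()

both-colours-present⇒NAE : ∀ {a b d} → Is12 a → Is12 b → Is12 d →
                           In3 a b d col1 → In3 a b d col2 → NAE a b d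
both-colours-present⇒NAE {a} {b} {d} a∈12 b∈12 d∈12 has1 has2 k = mk⇔ to from
  where
  to : In3 a b d k → Is12 k
  to (inj₁ refl) = a∈12
  to (inj₂ (inj₁ refl)) = b∈12
  to (inj₂ (inj₂ refl)) = d∈12
  from : Is12 k → In3 a b d k
  from (inj₁ refl) = has1
  from (inj₂ refl) = has2

NAE⇔NotAll₁×NotAll₂ : ∀ {a b d} → Is12 a → Is12 b → Is12 d →
                      NAE a b d ⇔ (NotAll col1 a b d × NotAll col2 a b d)
NAE⇔NotAll₁×NotAll₂ a∈12 b∈12 d∈12 = mk⇔
  (λ nae → NAE⇒NotAll (inj₁ refl) nae , NAE⇒NotAll (inj₂ refl) nae)
  (λ (not111 , not222) → both-colours-present⇒NAE a∈12 b∈12 d∈12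
     (other-colour-present (swap a∈12) (swap b∈12) (swap d∈12) not222)
     (other-colour-present a∈12 b∈12 d∈12 not111))

mainTheorem8 : (n m₁ m₂ : ℕ) → 1 ≤ n →
    (I : List (Triple n)) → WellFormed I →
    (C¹ : Graph (n + m₁ + n)) (L¹ : ListAssign (n + m₁ + n)) →
    (C² : Graph (n + m₂ + n)) (L² : ListAssign (n + m₂ + n)) →
    IsNotGadget col1 n m₁ I C¹ L¹ →
    IsNotGadget col2 n m₂ I C² L² →
    IsNAEGadget n (m₁ + n + m₂) I (chainE n m₁ m₂ C¹ C²) (chainL n m₁ m₂ L¹ L²)
mainTheorem8 _ _ _ _ _ _ _ _ _ _ not111 not222 = chain-isGadget NAE⇔NotAll₁×NotAll₂ not111 not222
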